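{- Let $M$ be a triangulation and $R=(T_0,T_1,T_2)$ a realizer of $M$. Suppose $M$ has an internal vertex $v$ of degree $3$, and let $M'$ be the triangulation obtained from $M$ by removing $v$ and its incident edges. Then the restriction of $R$ to $M'$ (the coloring of the internal edges of $M'$ inherited from $R$) is a realizer of $M'$.
   Context: A planar map is an embedding of a connected finite planar graph without loops or multiple edges in the sphere up to deformation, rooted by a chosen corner (giving root vertex and root face); vertices/edges on the root face are external, others internal. A triangulation is a rooted planar map with all faces of degree 3. Let $v_0$ be the root vertex, $v_1,v_2$ the other external vertices in counterclockwise order around the root face, $U$ the internal vertices. Tail/head of an oriented edge: its half-edge at origin/end. A realizer $R=(T_0,T_1,T_2)$ of $M$ is a coloring of the internal edges with colors $0,1,2$ such that for each $i$ the $i$-edges form a tree $T_i$ with vertex set $U\cup\{v_i\}$ oriented toward $v_i$, and in clockwise order around each internal vertex there is exactly one $0$-tail, some $1$-heads, exactly one $2$-tail, some $0$-heads, exactly one $1$-tail, some $2$-heads. -}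

module Defs where

open import Data.Nat using (ℕ; zero; suc; _+_; _<_; _≤_; _≤ᵇ_)
open import Data.Fin using (Fin; toℕ; #_)
open import Data.Bool using (Bool; true; false; if_then_else_)
open import Data.List using (List; upTo; allFin; map)
open import Data.Nat.ListAction using (sum)
open import Data.Bool.ListAction using (all)
open import Data.Product using (_×_; _,_; ∃; Σ)
open import Data.Sum using (_⊎_)
open import Relation.Binary.PropositionalEquality using (_≡_)
open import Relation.Nullary using (¬_)

iter : {A : Set} → (A → A) → ℕ → A → A
iter f zero    x = x
iter f (suc n) x = f (iter f n x)

-- Darts (half-edges) are Fin d.  α pairs the two darts of an edge
-- (fixed-point-free involution); σ sends a dart to the next dart in
-- COUNTERCLOCKWISE order around its origin vertex (σ⁻ = clockwise).
-- Vertices = σ-orbits, edges = α-orbits, faces = φ-orbits, φ = σ ∘ α.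
-- The root corner is the corner between the darts root and σ root
-- (at the root vertex); it lies in the face (φ-orbit) of σ root.

record RawMap : Set where
  field
    d       : ℕ
    α       : Fin d → Fin d
    σ       : Fin d → Fin d
    σ⁻      : Fin d → Fin d
    α-invol : ∀ x → α (α x) ≡ x
    α-nofix : ∀ x → ¬ (α x ≡ x)
    σ-left  : ∀ x → σ⁻ (σ x) ≡ x
    σ-right : ∀ x → σ (σ⁻ x) ≡ x
    root    : Fin d

open RawMap public

module _ (M : RawMap) where
  private
    D = Fin (d M)

  φ : D → D
  φ x = σ M (α M x)

  SameVertex : D → D → Set
  SameVertex x y = ∃ λ k → iter (σ M) k x ≡ y

  OrbitSize : (D → D) → D → ℕ → Set
  OrbitSize f x k = (0 < k) × (iter f k x ≡ x)
                    × (∀ j → 0 < j → j < k → ¬ (iter f j x ≡ x))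

  isOrbitMin : (D → D) → D → Bool
  isOrbitMin f x = all (λ k → toℕ x ≤ᵇ toℕ (iter f k x)) (upTo (d M))

  numOrbits : (D → D) → ℕ
  numOrbits f = sum (map (λ x → if isOrbitMin f x then 1 else 0) (allFin (d M)))

  data Reach : D → D → Set where
    here : ∀ {x} → Reach x x
    viaσ : ∀ {x y} → Reach (σ M x) y → Reach x y
    viaα : ∀ {x y} → Reach (α M x) y → Reach x y

  Connected : Set
  Connected = ∀ x y → Reach x y

  NoLoops : Set
  NoLoops = ∀ x → ¬ SameVertex x (α M x)

  NoMultipleEdges : Set
  NoMultipleEdges = ∀ x y → SameVertex x y → SameVertex (α M x) (α M y) → x ≡ y

  -- Euler: V - E + F = 2
  Euler : Set
  Euler = numOrbits (σ M) + numOrbits φ ≡ 2 + numOrbits (α M)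

  IsPlanarMap : Set
  IsPlanarMap = Connected × NoLoops × NoMultipleEdges × Euler

  IsTriangulation : Set
  IsTriangulation = IsPlanarMap × (∀ x → OrbitSize φ x 3)

  InRootFace : D → Set
  InRootFace x = ∃ λ k → iter φ k (σ M (root M)) ≡ x

  ExternalEdge : D → Set
  ExternalEdge x = InRootFace x ⊎ InRootFace (α M x)

  -- darts whose origins are v₀, v₁, v₂ (v₁, v₂ follow v₀ counterclockwise
  -- around the root face; faces are traversed by φ counterclockwise
  -- when the root face is drawn as the outer face)
  extDart : Fin 3 → D
  extDart i = go (toℕ i)
    where
    go : ℕ → D
    go zero          = σ M (root M)
    go (suc zero)    = α M (σ M (root M))
    go (suc (suc _)) = α M (φ (σ M (root M)))

  Internal : D → Set
  Internal x = ∀ i → ¬ SameVertex x (extDart i)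

-- Realizers, encoded as a labelling of darts: the dart of an internal
-- i-edge at its origin is its tail (tl i), the other dart is its head
-- (hd i); darts of external edges are labelled ext.

data Lab : Set where
  tl hd : Fin 3 → Lab
  ext   : Lab

module _ (M : RawMap) (R : Fin (d M) → Lab) where
  private
    D = Fin (d M)

  data ToRoot (i : Fin 3) : D → Set where
    base : ∀ {x} → SameVertex M x (extDart M i) → ToRoot i x
    step : ∀ {x y} → SameVertex M x y → R y ≡ tl i → ToRoot i (α M y) → ToRoot i x

  -- the i-edges form a tree with vertex set U ∪ {v_i} oriented toward v_i
  record IsTree (i : Fin 3) : Set where
    field
      vertices : ∀ x → (R x ≡ tl i ⊎ R x ≡ hd i) → Internal M x ⊎ SameVertex M x (extDart M i)
      oneTail  : ∀ x → Internal M x → ∃ λ y → SameVertex M x y × R y ≡ tl i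
                   × (∀ z → SameVertex M x z → R z ≡ tl i → z ≡ y)
      rootNoTail : ∀ x → SameVertex M (extDart M i) x → ¬ (R x ≡ tl i)
      toRoot   : ∀ x → Internal M x → ToRoot i x

  -- clockwise around the vertex of x: one 0-tail, 1-heads, one 2-tail,
  -- 0-heads, one 1-tail, 2-heads (a, b, c ≥ 0 heads respectively)
  LocalRule : D → Set
  LocalRule x = Σ D λ y → SameVertex M x y × (∃ λ a → ∃ λ b → ∃ λ c →
      let cw = λ k → iter (σ⁻ M) k y in
      OrbitSize M (σ⁻ M) y (3 + a + b + c)
    × R (cw 0) ≡ tl (# 0)
    × (∀ k → 1 ≤ k → k ≤ a → R (cw k) ≡ hd (# 1))
    × R (cw (1 + a)) ≡ tl (# 2)
    × (∀ k → 2 + a ≤ k → k ≤ 1 + a + b → R (cw k) ≡ hd (# 0))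
    × R (cw (2 + a + b)) ≡ tl (# 1)
    × (∀ k → 3 + a + b ≤ k → k ≤ 2 + a + b + c → R (cw k) ≡ hd (# 2)))

  record IsRealizer : Set where
    field
      tl-α     : ∀ x i → R x ≡ tl i → R (α M x) ≡ hd i
      hd-α     : ∀ x i → R x ≡ hd i → R (α M x) ≡ tl i
      ext→     : ∀ x → R x ≡ ext → ExternalEdge M x
      →ext     : ∀ x → ExternalEdge M x → R x ≡ ext
      trees    : ∀ i → IsTree i
      local    : ∀ x → Internal M x → LocalRule x

-- M' is obtained from M by deleting the vertex of dart v and its incident
-- edges: ι identifies the darts of M' with the darts of M not incident
-- to v; α is inherited, the rotation skips deleted darts, root kept.

record Deletion (M : RawMap) (v : Fin (d M)) (M' : RawMap) : Set where
  field
    ι       : Fin (d M') → Fin (d M)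
    ι-inj   : ∀ x y → ι x ≡ ι y → x ≡ y
    ι-avoid : ∀ x → ¬ SameVertex M (ι x) v × ¬ SameVertex M (α M (ι x)) v
    ι-onto  : ∀ y → ¬ SameVertex M y v → ¬ SameVertex M (α M y) v → ∃ λ x → ι x ≡ y
    ι-α     : ∀ x → ι (α M' x) ≡ α M (ι x)
    ι-σ     : ∀ x → ∃ λ k → 0 < k × ι (σ M' x) ≡ iter (σ M) k (ι x)
                × (∀ j → 0 < j → j < k → SameVertex M (α M (iter (σ M) j (ι x))) v)
    ι-root  : ι (root M') ≡ root M

-- All three darts at a degree-3 internal vertex v are tails: the local rule leaves no
-- room for heads. So every edge at v is a head at its other end, and deleting v removes
-- only heads from the rotations of the surviving vertices; the external triangle does
-- not touch v at all. Hence every tail survives, the trees keep their paths to the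
-- roots, and the clockwise word "0-tail, 1-heads, 2-tail, 0-heads, 1-tail, 2-heads"
-- around each remaining vertex keeps its shape, with shorter runs of heads.
module Submission where

open import Defs
open import Data.Fin using (Fin; zero; suc; #_)
open import Data.Nat using (ℕ; zero; suc; _+_; _*_; _∸_; _≤_; _<_; _≤?_; z≤n; s≤s; NonZero)
open import Data.Nat.DivMod using (_%_; _/_; m≡m%n+[m/n]*n; m%n<n)
open import Data.Nat.Induction using (<-rec)
open import Data.Nat.Properties
open import Data.Product using (∃; _×_; _,_; proj₁; proj₂)
open import Data.Sum using (inj₁; inj₂) renaming (map to ⊎-map)
open import Function using (_∘_)
open import Relation.Binary using (tri<; tri≈; tri>)
open import Relation.Binary.PropositionalEquality
open import Relation.Nullary using (¬_; yes; no; contradiction)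

module _ {A : Set} (f : A → A) where

  iter-+ : ∀ m n x → iter f (m + n) x ≡ iter f m (iter f n x)
  iter-+ zero    n x = refl
  iter-+ (suc m) n x = cong f (iter-+ m n x)

  iter-comm : ∀ m n x → iter f m (iter f n x) ≡ iter f n (iter f m x)
  iter-comm m n x = begin
    iter f m (iter f n x) ≡⟨ iter-+ m n x ⟨
    iter f (m + n) x      ≡⟨ cong (λ k → iter f k x) (+-comm m n) ⟩
    iter f (n + m) x      ≡⟨ iter-+ n m x ⟩
    iter f n (iter f m x) ∎
    where open ≡-Reasoning

  module _ (n : ℕ) {x : A} (period : iter f n x ≡ x) where

    iter-period-* : ∀ l → iter f (l * n) x ≡ x
    iter-period-* zero    = refl
    iter-period-* (suc l) = begin
      iter f (n + l * n) x      ≡⟨ iter-+ n (l * n) x ⟩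
      iter f n (iter f (l * n) x) ≡⟨ cong (iter f n) (iter-period-* l) ⟩
      iter f n x                ≡⟨ period ⟩
      x                         ∎
      where open ≡-Reasoning

    iter-period-% : .{{_ : NonZero n}} → ∀ m → iter f m x ≡ iter f (m % n) x
    iter-period-% m = begin
      iter f m x                                ≡⟨ cong (λ k → iter f k x) (m≡m%n+[m/n]*n m n) ⟩
      iter f (m % n + (m / n) * n) x            ≡⟨ iter-+ (m % n) ((m / n) * n) x ⟩
      iter f (m % n) (iter f ((m / n) * n) x)   ≡⟨ cong (iter f (m % n)) (iter-period-* (m / n)) ⟩
      iter f (m % n) x                          ∎
      where open ≡-Reasoning

    iter-period-orbit : ∀ l → iter f n (iter f l x) ≡ iter f l x
    iter-period-orbit l = trans (iter-comm n l x) (cong (iter f l) period)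

module _ {A : Set} (f g : A → A) (g∘f : ∀ x → g (f x) ≡ x) where

  iter-inverseˡ : ∀ k x → iter g k (iter f k x) ≡ x
  iter-inverseˡ zero    x = refl
  iter-inverseˡ (suc k) x = begin
    g (iter g k (f (iter f k x))) ≡⟨ cong (g ∘ iter g k) (iter-comm f 1 k x) ⟩
    g (iter g k (iter f k (f x))) ≡⟨ cong g (iter-inverseˡ k (f x)) ⟩
    g (f x)                        ≡⟨ g∘f x ⟩
    x                              ∎
    where open ≡-Reasoning

  iter-inverse-solve : ∀ k {x y} → iter f k x ≡ y → x ≡ iter g k y
  iter-inverse-solve k {x} refl = sym (iter-inverseˡ k x)

  iter-inverse-period : ∀ n {x} → iter f n x ≡ x → iter g n x ≡ x
  iter-inverse-period n period = sym (iter-inverse-solve n period)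

  iter-inverse-as-iter : ∀ {m x} → iter f (suc m) x ≡ x → ∀ k → iter g k x ≡ iter f (k * m) x
  iter-inverse-as-iter {m} {x} period k = sym (iter-inverse-solve k (begin
    iter f k (iter f (k * m) x) ≡⟨ iter-+ f k (k * m) x ⟨
    iter f (k + k * m) x        ≡⟨ cong (λ j → iter f j x) (*-suc k m) ⟨
    iter f (k * suc m) x        ≡⟨ iter-period-* f (suc m) period k ⟩
    x                           ∎))
    where open ≡-Reasoning

  iter-inverse-cancel : ∀ {i j} → i ≤ j → ∀ x → iter g i (iter f j x) ≡ iter f (j ∸ i) x
  iter-inverse-cancel {i} {j} i≤j x = begin
    iter g i (iter f j x)                  ≡⟨ cong (λ k → iter g i (iter f k x)) (m+[n∸m]≡n i≤j) ⟨
    iter g i (iter f (i + (j ∸ i)) x)      ≡⟨ cong (iter g i) (iter-+ f i (j ∸ i) x) ⟩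
    iter g i (iter f i (iter f (j ∸ i) x)) ≡⟨ iter-inverseˡ i _ ⟩
    iter f (j ∸ i) x                       ∎
    where open ≡-Reasoning

module _ (e : ℕ → ℕ) (e-step : ∀ k → e k < e (suc k)) where

  increasing-mono : ∀ {i j} → i < j → e i < e j
  increasing-mono {i} {suc j} (s≤s i≤j) with m≤n⇒m<n∨m≡n i≤j
  ... | inj₁ i<j  = <-trans (increasing-mono i<j) (e-step j)
  ... | inj₂ refl = e-step j

  increasing-reflects : ∀ {i j m n} → e i ≡ m → e j ≡ n → m < n → i < j
  increasing-reflects {i} {j} refl refl ei<ej with <-cmp i j
  ... | tri< i<j _ _ = i<j
  ... | tri≈ _ refl _ = contradiction ei<ej (<-irrefl refl)
  ... | tri> _ _ j<i = contradiction (increasing-mono j<i) (<-asym ei<ej)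

  increasing-bracket : ∀ t → e 0 ≤ t → ∃ λ k → e k ≤ t × t < e (suc k)
  increasing-bracket zero    e0≤0 = 0 , e0≤0 , ≤-<-trans z≤n (e-step 0)
  increasing-bracket (suc t) e0≤t+1 with e 0 ≤? t
  ... | no e0≰t = 0 , e0≤t+1 , ≤-<-trans (≰⇒> e0≰t) (e-step 0)
  ... | yes e0≤t with increasing-bracket t e0≤t
  ...   | k , ek≤t , t<ek+1 with m≤n⇒m<n∨m≡n t<ek+1
  ...     | inj₁ t+1<ek+1 = k , m≤n⇒m≤1+n ek≤t , t+1<ek+1
  ...     | inj₂ t+1≡ek+1 = suc k , ≤-reflexive (sym t+1≡ek+1) ,
                              subst (_< e (suc (suc k))) (sym t+1≡ek+1) (e-step (suc k))

  increasing-hits : {P : ℕ → Set} → (∀ k t → e k < t → t < e (suc k) → P t)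
                  → ∀ t → e 0 ≤ t → ¬ P t → ∃ λ k → e k ≡ t
  increasing-hits gap t e0≤t ¬Pt with increasing-bracket t e0≤t
  ... | k , ek≤t , t<ek+1 with m≤n⇒m<n∨m≡n ek≤t
  ...   | inj₁ ek<t = contradiction (gap k t ek<t t<ek+1) ¬Pt
  ...   | inj₂ ek≡t = k , ek≡t

  increasing-between : ∀ {i k j m n} → e i ≡ m → e j ≡ n → i < k → k < j → m < e k × e k < n
  increasing-between refl refl i<k k<j = increasing-mono i<k , increasing-mono k<j

ordered-split : ∀ {A B N} → 0 < A → A < B → B < N →
                ∃ λ a → ∃ λ b → ∃ λ c → 1 + a ≡ A × 2 + a + b ≡ B × 3 + a + b + c ≡ N
ordered-split {suc a} _ A<B B<N with m≤n⇒∃[o]m+o≡n A<B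
... | b , refl with m≤n⇒∃[o]m+o≡n B<N
...   | c , refl = a , b , c , refl , refl , refl

-- LocalRule x unfolds to: a dart y at x, sizes a b c, the σ⁻-orbit size of y, and
-- RotationWord (λ k → R (iter (σ⁻ M) k y)) a b c.
RotationWord : (ℕ → Lab) → ℕ → ℕ → ℕ → Set
RotationWord L a b c =
    L 0 ≡ tl (# 0)
  × (∀ k → 1 ≤ k → k ≤ a → L k ≡ hd (# 1))
  × L (1 + a) ≡ tl (# 2)
  × (∀ k → 2 + a ≤ k → k ≤ 1 + a + b → L k ≡ hd (# 0))
  × L (2 + a + b) ≡ tl (# 1)
  × (∀ k → 3 + a + b ≤ k → k ≤ 2 + a + b + c → L k ≡ hd (# 2))

rotationWord-cong : ∀ {L L′ a b c} → (∀ k → L k ≡ L′ k) → RotationWord L a b c → RotationWord L′ a b c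
rotationWord-cong {L} {L′} L≗L′ (w0 , wA , w2 , wB , w1 , wC) =
  move w0 , (λ k lo hi → move (wA k lo hi)) , move w2 , (λ k lo hi → move (wB k lo hi)) ,
  move w1 , (λ k lo hi → move (wC k lo hi))
  where
  move : ∀ {k l} → L k ≡ l → L′ k ≡ l
  move {k} = trans (sym (L≗L′ k))

rotationWord-subsequence :
  ∀ {L a b c} (e : ℕ → ℕ) → (∀ k → e k < e (suc k)) → e 0 ≡ 0
  → (∀ t i → L t ≡ tl i → ∃ λ k → e k ≡ t)
  → RotationWord L a b c → L (3 + a + b + c) ≡ tl (# 0)
  → ∃ λ a′ → ∃ λ b′ → ∃ λ c′ → RotationWord (L ∘ e) a′ b′ c′ × e (3 + a′ + b′ + c′) ≡ 3 + a + b + c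
rotationWord-subsequence {L} e e-step e0 hits (w0 , wA , w2 , wB , w1 , wC) wN
  with hits _ _ w2 | hits _ _ w1 | hits _ _ wN
... | A , eA | B , eB | N , eN
  with ordered-split (increasing-reflects e e-step e0 eA (s≤s z≤n))
                     (increasing-reflects e e-step eA eB (s≤s (s≤s (m≤m+n _ _))))
                     (increasing-reflects e e-step eB eN (s≤s (s≤s (s≤s (m≤m+n _ _)))))
...   | a′ , b′ , c′ , refl , refl , refl =
  a′ , b′ , c′ ,
  ( trans (cong L e0) w0
  , (λ k lo hi → let l , h = between e0 eA lo (s≤s hi) in wA (e k) l (≤-pred h))
  , trans (cong L eA) w2
  , (λ k lo hi → let l , h = between eA eB lo (s≤s hi) in wB (e k) l (≤-pred h))
  , trans (cong L eB) w1
  , (λ k lo hi → let l , h = between eB eN lo (s≤s hi) in wC (e k) l (≤-pred h)) )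
  , eN
  where between = increasing-between e e-step

rotationWord-length3 : ∀ {L a b c} → RotationWord L a b c → 3 + a + b + c ≤ 3 →
                       ∀ r → r < 3 → ∃ λ i → L r ≡ tl i
rotationWord-length3 {a = zero}  {zero}  {zero}  (w0 , _ , _  , _ , _  , _) _ 0 _ = _ , w0
rotationWord-length3 {a = zero}  {zero}  {zero}  (_  , _ , w2 , _ , _  , _) _ 1 _ = _ , w2
rotationWord-length3 {a = zero}  {zero}  {zero}  (_  , _ , _  , _ , w1 , _) _ 2 _ = _ , w1
rotationWord-length3 {a = zero}  {zero}  {zero}  _ _ (suc (suc (suc r))) (s≤s (s≤s (s≤s ())))
rotationWord-length3 {a = suc a}                 _ (s≤s (s≤s (s≤s ()))) _ _
rotationWord-length3 {a = zero}  {suc b}         _ (s≤s (s≤s (s≤s ()))) _ _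
rotationWord-length3 {a = zero}  {zero}  {suc c} _ (s≤s (s≤s (s≤s ()))) _ _

module _ (M : RawMap) where

  sameVertex-refl : ∀ {x} → SameVertex M x x
  sameVertex-refl = 0 , refl

  sameVertex-trans : ∀ {x y z} → SameVertex M x y → SameVertex M y z → SameVertex M x z
  sameVertex-trans {x} (k , refl) (l , refl) = l + k , iter-+ (σ M) l k x

  sameVertex-σ⁻ : ∀ {x y} → (p : SameVertex M x y) → x ≡ iter (σ⁻ M) (proj₁ p) y
  sameVertex-σ⁻ (k , p) = iter-inverse-solve (σ M) (σ⁻ M) (σ-left M) k p

  sameVertex-sym : ∀ {m x y} → iter (σ M) (suc m) y ≡ y → SameVertex M x y → SameVertex M y x
  sameVertex-sym {m} period p@(k , _) =
    k * m , sym (trans (sameVertex-σ⁻ p) (iter-inverse-as-iter (σ M) (σ⁻ M) (σ-left M) period k))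

module _ {M : RawMap} {R : Fin (d M) → Lab} (real : IsRealizer M R)
         {v : Fin (d M)} (v-internal : Internal M v) (v-degree3 : iter (σ M) 3 v ≡ v) where
  open IsRealizer real

  degree3-tail : ∀ {z} → SameVertex M z v → ∃ λ i → R z ≡ tl i
  degree3-tail {z} z~v@(k , _) with local v v-internal
  ... | y , v~y@(l , refl) , a , b , c , (_ , _ , minimal) , word =
    let i , t = rotationWord-length3 word length≤3 ((k + l) % 3) (m%n<n (k + l) 3)
    in  i , trans (cong R z≡) t
    where
    y-period : iter (σ⁻ M) 3 y ≡ y
    y-period = iter-inverse-period (σ M) (σ⁻ M) (σ-left M) 3 (iter-period-orbit (σ M) 3 v-degree3 l)
    length≤3 : 3 + a + b + c ≤ 3
    length≤3 = ≮⇒≥ (λ 3<length → minimal 3 (s≤s z≤n) 3<length y-period)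
    z≡ : z ≡ iter (σ⁻ M) ((k + l) % 3) y
    z≡ = begin
      z                                   ≡⟨ sameVertex-σ⁻ M z~v ⟩
      iter (σ⁻ M) k v                     ≡⟨ cong (iter (σ⁻ M) k) (sameVertex-σ⁻ M v~y) ⟩
      iter (σ⁻ M) k (iter (σ⁻ M) l y)     ≡⟨ iter-+ (σ⁻ M) k l y ⟨
      iter (σ⁻ M) (k + l) y               ≡⟨ iter-period-% (σ⁻ M) 3 y-period (k + l) ⟩
      iter (σ⁻ M) ((k + l) % 3) y         ∎
      where open ≡-Reasoning

  tail-twin-avoids : ∀ {z i} → R z ≡ tl i → ¬ SameVertex M (α M z) v
  tail-twin-avoids {z} {i} t twin~v with degree3-tail twin~v
  ... | j , t′ with trans (sym (tl-α z i t)) t′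
  ...   | ()

module _ {M : RawMap} {v : Fin (d M)} {M′ : RawMap} (D : Deletion M v M′) where
  open Deletion D

  ι-sameVertex : ∀ {x y} → SameVertex M′ x y → SameVertex M (ι x) (ι y)
  ι-sameVertex {x} (k , refl) = ι-iter k
    where
    ι-iter : ∀ k → SameVertex M (ι x) (ι (iter (σ M′) k x))
    ι-iter zero    = sameVertex-refl M
    ι-iter (suc k) with ι-σ (iter (σ M′) k x)
    ... | j , _ , ι-step , _ = sameVertex-trans M (ι-iter k) (j , sym ι-step)

  sameVertex-ι⁻¹ : ∀ {x y} → SameVertex M (ι x) (ι y) → SameVertex M′ x y
  sameVertex-ι⁻¹ {x} {y} (n , p) = <-rec P walk n x p
    where
    P : ℕ → Set
    P n = ∀ x → iter (σ M) n (ι x) ≡ ι y → SameVertex M′ x y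
    walk : ∀ n → (∀ {m} → m < n → P m) → P n
    walk zero    _    x p = 0 , ι-inj x y p
    walk (suc n) rest x p with ι-σ x
    ... | k , 0<k , ι-step , skipped with k ≤? suc n
    ...   | no k≰n = contradiction
                       (subst (λ u → SameVertex M (α M u) v) p (skipped (suc n) (s≤s z≤n) (≰⇒> k≰n)))
                       (proj₂ (ι-avoid y))
    ...   | yes k≤n = sameVertex-trans M′ (1 , refl) (rest (∸-monoʳ-< 0<k k≤n) (σ M′ x) (begin
        iter (σ M) (suc n ∸ k) (ι (σ M′ x))        ≡⟨ cong (iter (σ M) (suc n ∸ k)) ι-step ⟩
        iter (σ M) (suc n ∸ k) (iter (σ M) k (ι x)) ≡⟨ iter-+ (σ M) (suc n ∸ k) k (ι x) ⟨
        iter (σ M) (suc n ∸ k + k) (ι x)           ≡⟨ cong (λ m → iter (σ M) m (ι x)) (m∸n+n≡m k≤n) ⟩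
        iter (σ M) (suc n) (ι x)                   ≡⟨ p ⟩
        ι y                                        ∎))
      where open ≡-Reasoning

  ι-σ-kept : ∀ {w u} → ι w ≡ u → ¬ SameVertex M (α M (σ M u)) v → ι (σ M′ w) ≡ σ M u
  ι-σ-kept {w} refl kept with ι-σ w
  ... | suc zero    , _ , ι-step , _       = ι-step
  ... | suc (suc k) , _ , _      , skipped = contradiction (skipped 1 (s≤s z≤n) (s≤s (s≤s z≤n))) kept

  ι-σ⁻ : ∀ x → ∃ λ j → 0 < j × ι (σ⁻ M′ x) ≡ iter (σ⁻ M) j (ι x)
                 × (∀ i → 0 < i → i < j → SameVertex M (α M (iter (σ⁻ M) i (ι x))) v)
  ι-σ⁻ x with ι-σ (σ⁻ M′ x)
  ... | j , 0<j , ι-step , skipped = j , 0<j , ι-step⁻ , skipped⁻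
    where
    ιx≡ : iter (σ M) j (ι (σ⁻ M′ x)) ≡ ι x
    ιx≡ = trans (sym ι-step) (cong ι (σ-right M′ x))
    ι-step⁻ : ι (σ⁻ M′ x) ≡ iter (σ⁻ M) j (ι x)
    ι-step⁻ = iter-inverse-solve (σ M) (σ⁻ M) (σ-left M) j ιx≡
    skipped⁻ : ∀ i → 0 < i → i < j → SameVertex M (α M (iter (σ⁻ M) i (ι x))) v
    skipped⁻ i 0<i i<j = subst (λ u → SameVertex M (α M u) v) back
      (skipped (j ∸ i) (m<n⇒0<n∸m i<j) (∸-monoʳ-< 0<i (<⇒≤ i<j)))
      where
      back : iter (σ M) (j ∸ i) (ι (σ⁻ M′ x)) ≡ iter (σ⁻ M) i (ι x)
      back = trans (sym (iter-inverse-cancel (σ M) (σ⁻ M) (σ-left M) (<⇒≤ i<j) _))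
                   (cong (iter (σ⁻ M) i) ιx≡)

  module Clockwise (x : Fin (d M′)) where

    pos : ℕ → ℕ
    pos zero    = 0
    pos (suc k) = proj₁ (ι-σ⁻ (iter (σ⁻ M′) k x)) + pos k

    ι-clockwise : ∀ k → ι (iter (σ⁻ M′) k x) ≡ iter (σ⁻ M) (pos k) (ι x)
    ι-clockwise zero    = refl
    ι-clockwise (suc k) = let j , _ , ι-step , _ = ι-σ⁻ (iter (σ⁻ M′) k x) in begin
      ι (σ⁻ M′ (iter (σ⁻ M′) k x))               ≡⟨ ι-step ⟩
      iter (σ⁻ M) j (ι (iter (σ⁻ M′) k x))       ≡⟨ cong (iter (σ⁻ M) j) (ι-clockwise k) ⟩
      iter (σ⁻ M) j (iter (σ⁻ M) (pos k) (ι x))  ≡⟨ iter-+ (σ⁻ M) j (pos k) (ι x) ⟨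
      iter (σ⁻ M) (j + pos k) (ι x)              ∎
      where open ≡-Reasoning

    pos-step : ∀ k → pos k < pos (suc k)
    pos-step k = m<n+m (pos k) (proj₁ (proj₂ (ι-σ⁻ (iter (σ⁻ M′) k x))))

    pos-gap : ∀ k t → pos k < t → t < pos (suc k) → SameVertex M (α M (iter (σ⁻ M) t (ι x))) v
    pos-gap k t pos<t t<pos′ =
      let j , _ , _ , skipped = ι-σ⁻ (iter (σ⁻ M′) k x)
          offset<j : t ∸ pos k < j
          offset<j = +-cancelʳ-< (pos k) (t ∸ pos k) j (subst (_< j + pos k) (sym t≡) t<pos′)
      in  subst (λ u → SameVertex M (α M u) v) at-t (skipped (t ∸ pos k) (m<n⇒0<n∸m pos<t) offset<j)
      where
      t≡ : t ∸ pos k + pos k ≡ t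
      t≡ = m∸n+n≡m (<⇒≤ pos<t)
      at-t : iter (σ⁻ M) (t ∸ pos k) (ι (iter (σ⁻ M′) k x)) ≡ iter (σ⁻ M) t (ι x)
      at-t = begin
        iter (σ⁻ M) (t ∸ pos k) (ι (iter (σ⁻ M′) k x))        ≡⟨ cong (iter (σ⁻ M) (t ∸ pos k)) (ι-clockwise k) ⟩
        iter (σ⁻ M) (t ∸ pos k) (iter (σ⁻ M) (pos k) (ι x))   ≡⟨ iter-+ (σ⁻ M) (t ∸ pos k) (pos k) (ι x) ⟨
        iter (σ⁻ M) (t ∸ pos k + pos k) (ι x)                 ≡⟨ cong (λ m → iter (σ⁻ M) m (ι x)) t≡ ⟩
        iter (σ⁻ M) t (ι x)                                   ∎
        where open ≡-Reasoning

    clockwise-orbitSize : ∀ {n N} → OrbitSize M (σ⁻ M) (ι x) n → pos N ≡ n → OrbitSize M′ (σ⁻ M′) x N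
    clockwise-orbitSize {n} {N} (0<n , period , minimal) posN≡n =
      increasing-reflects pos pos-step refl posN≡n 0<n ,
      ι-inj _ _ (trans (ι-clockwise N) (trans (cong (λ m → iter (σ⁻ M) m (ι x)) posN≡n) period)) ,
      λ j 0<j j<N eq → let lo , hi = increasing-between pos pos-step refl posN≡n 0<j j<N
                       in minimal (pos j) lo hi (trans (sym (ι-clockwise j)) (cong ι eq))

Kept : (M : RawMap) → Fin (d M) → Fin (d M) → Set
Kept M v z = ¬ SameVertex M z v × ¬ SameVertex M (α M z) v

module _ {M : RawMap} (triangulation : IsTriangulation M)
         {v : Fin (d M)} (v-internal : Internal M v) (v-degree3 : iter (σ M) 3 v ≡ v) where

  private
    r : Fin (d M)
    r = σ M (root M)

    at-external : ∀ {z} i → SameVertex M z (extDart M i) → ¬ SameVertex M z v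
    at-external i z~ext z~v =
      v-internal i (sameVertex-trans M (sameVertex-sym M {m = 2} v-degree3 z~v) z~ext)

    after-external : ∀ {z} i → SameVertex M (extDart M i) z → ¬ SameVertex M z v
    after-external i ext~z z~v =
      v-internal i (sameVertex-sym M {m = 2} v-degree3 (sameVertex-trans M ext~z z~v))

  rootFace-kept : ∀ {z} → InRootFace M z → Kept M v z
  rootFace-kept (k , refl) =
    subst (Kept M v) (sym (iter-period-% (φ M) 3 r-period k)) (corner (k % 3) (m%n<n k 3))
    where
    r-period : iter (φ M) 3 r ≡ r
    r-period = proj₁ (proj₂ (proj₂ triangulation r))
    corner : ∀ j → j < 3 → Kept M v (iter (φ M) j r)
    corner 0 _ = at-external (# 0) (0 , refl) , at-external (# 1) (0 , refl)
    corner 1 _ = after-external (# 1) (1 , refl) , at-external (# 2) (0 , refl)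
    corner 2 _ = after-external (# 2) (1 , refl) , at-external (# 0) (1 , r-period)
    corner (suc (suc (suc _))) (s≤s (s≤s (s≤s ())))

module _ {M : RawMap} (triangulation : IsTriangulation M)
         {v : Fin (d M)} (v-internal : Internal M v) (v-degree3 : iter (σ M) 3 v ≡ v)
         {M′ : RawMap} (D : Deletion M v M′) where
  open Deletion D

  private
    rootFace-twin-kept : ∀ k → ¬ SameVertex M (α M (iter (φ M) k (σ M (root M)))) v
    rootFace-twin-kept k = proj₂ (rootFace-kept triangulation v-internal v-degree3 (k , refl))

  ι-rootFace : ∀ k → ι (iter (φ M′) k (σ M′ (root M′))) ≡ iter (φ M) k (σ M (root M))
  ι-rootFace zero    = ι-σ-kept D ι-root (rootFace-twin-kept 0)
  ι-rootFace (suc k) = ι-σ-kept D (trans (ι-α _) (cong (α M) (ι-rootFace k))) (rootFace-twin-kept (suc k))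

  ι-extDart : ∀ i → ι (extDart M′ i) ≡ extDart M i
  ι-extDart zero             = ι-rootFace 0
  ι-extDart (suc zero)       = trans (ι-α _) (cong (α M) (ι-rootFace 0))
  ι-extDart (suc (suc zero)) = trans (ι-α _) (cong (α M) (ι-rootFace 1))

  inRootFace-ι : ∀ {x} → InRootFace M′ x → InRootFace M (ι x)
  inRootFace-ι (k , refl) = k , sym (ι-rootFace k)

  inRootFace-ι⁻¹ : ∀ {x} → InRootFace M (ι x) → InRootFace M′ x
  inRootFace-ι⁻¹ (k , p) = k , ι-inj _ _ (trans (ι-rootFace k) p)

  externalEdge-ι : ∀ {x} → ExternalEdge M′ x → ExternalEdge M (ι x)
  externalEdge-ι (inj₁ p) = inj₁ (inRootFace-ι p)
  externalEdge-ι (inj₂ p) = inj₂ (subst (InRootFace M) (ι-α _) (inRootFace-ι p))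

  externalEdge-ι⁻¹ : ∀ {x} → ExternalEdge M (ι x) → ExternalEdge M′ x
  externalEdge-ι⁻¹ (inj₁ p) = inj₁ (inRootFace-ι⁻¹ p)
  externalEdge-ι⁻¹ (inj₂ p) = inj₂ (inRootFace-ι⁻¹ (subst (InRootFace M) (sym (ι-α _)) p))

  sameVertex-extDart-ι⁻¹ : ∀ {x} i → SameVertex M (ι x) (extDart M i) → SameVertex M′ x (extDart M′ i)
  sameVertex-extDart-ι⁻¹ {x} i p = sameVertex-ι⁻¹ D (subst (SameVertex M (ι x)) (sym (ι-extDart i)) p)

  internal-ι : ∀ {x} → Internal M′ x → Internal M (ι x)
  internal-ι x-internal i p = x-internal i (sameVertex-extDart-ι⁻¹ i p)

  internal-ι⁻¹ : ∀ {x} → Internal M (ι x) → Internal M′ x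
  internal-ι⁻¹ {x} ιx-internal i p = ιx-internal i (subst (SameVertex M (ι x)) (ι-extDart i) (ι-sameVertex D p))

  module _ {R : Fin (d M) → Lab} (real : IsRealizer M R) where
    open IsRealizer real

    private
      R′ : Fin (d M′) → Lab
      R′ x = R (ι x)

    tail-survives : ∀ {x y i} → SameVertex M (ι x) y → R y ≡ tl i → ∃ λ y′ → ι y′ ≡ y
    tail-survives {x} x~y y-tail =
      ι-onto _ (λ y~v → proj₁ (ι-avoid x) (sameVertex-trans M x~y y~v))
               (tail-twin-avoids real v-internal v-degree3 y-tail)

    restrict-toRoot : ∀ {i u} → ToRoot M R i u → ∀ x → ι x ≡ u → ToRoot M′ R′ i x
    restrict-toRoot {i} (base p) x refl = base (sameVertex-extDart-ι⁻¹ i p)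
    restrict-toRoot (step x~y y-tail rest) x refl with tail-survives x~y y-tail
    ... | y′ , refl = step (sameVertex-ι⁻¹ D x~y) y-tail (restrict-toRoot rest (α M′ y′) (ι-α y′))

    restrict-tree : ∀ i → IsTree M′ R′ i
    restrict-tree i = record
      { vertices   = λ x e → ⊎-map internal-ι⁻¹ (sameVertex-extDart-ι⁻¹ i) (vertices (ι x) e)
      ; oneTail    = oneTail′
      ; rootNoTail = λ x p → rootNoTail (ι x) (subst (λ u → SameVertex M u (ι x)) (ι-extDart i) (ι-sameVertex D p))
      ; toRoot     = λ x x-internal → restrict-toRoot (toRoot (ι x) (internal-ι x-internal)) x refl
      }
      where
      open IsTree (trees i)
      oneTail′ : ∀ x → Internal M′ x → ∃ λ y → SameVertex M′ x y × R′ y ≡ tl i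
                 × (∀ z → SameVertex M′ x z → R′ z ≡ tl i → z ≡ y)
      oneTail′ x x-internal with oneTail (ι x) (internal-ι x-internal)
      ... | y , x~y , y-tail , unique with tail-survives x~y y-tail
      ...   | y′ , refl = y′ , sameVertex-ι⁻¹ D x~y , y-tail ,
                          λ z x~z z-tail → ι-inj _ _ (unique (ι z) (ι-sameVertex D x~z) z-tail)

    clockwise-rotationWord : ∀ y′ {a b c} → OrbitSize M (σ⁻ M) (ι y′) (3 + a + b + c)
      → RotationWord (λ k → R (iter (σ⁻ M) k (ι y′))) a b c
      → ∃ λ a′ → ∃ λ b′ → ∃ λ c′ → OrbitSize M′ (σ⁻ M′) y′ (3 + a′ + b′ + c′)
                                 × RotationWord (λ k → R′ (iter (σ⁻ M′) k y′)) a′ b′ c′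
    clockwise-rotationWord y′ orbit@(_ , period , _) word =
      let a′ , b′ , c′ , word′ , pos≡ = rotationWord-subsequence pos pos-step refl tail-hit word
                                          (trans (cong R period) (proj₁ word))
      in  a′ , b′ , c′ , clockwise-orbitSize orbit pos≡ ,
          rotationWord-cong (λ k → cong R (sym (ι-clockwise k))) word′
      where
      open Clockwise D y′
      tail-hit : ∀ t i → R (iter (σ⁻ M) t (ι y′)) ≡ tl i → ∃ λ k → pos k ≡ t
      tail-hit t i t-tail =
        increasing-hits pos pos-step pos-gap t z≤n (tail-twin-avoids real v-internal v-degree3 t-tail)

    restrict-localRule : ∀ x → Internal M′ x → LocalRule M′ R′ x
    restrict-localRule x x-internal with local (ι x) (internal-ι x-internal)
    ... | y , x~y , _ , _ , _ , orbit , word with tail-survives x~y (proj₁ word)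
    ...   | y′ , refl = y′ , sameVertex-ι⁻¹ D x~y , clockwise-rotationWord y′ orbit word

    restrict-realizer : IsRealizer M′ R′
    restrict-realizer = record
      { tl-α  = λ x i t → trans (cong R (ι-α x)) (tl-α (ι x) i t)
      ; hd-α  = λ x i h → trans (cong R (ι-α x)) (hd-α (ι x) i h)
      ; ext→  = λ x e → externalEdge-ι⁻¹ (ext→ (ι x) e)
      ; →ext  = λ x e → →ext (ι x) (externalEdge-ι e)
      ; trees = restrict-tree
      ; local = restrict-localRule
      }

lemma5p3 : (M : RawMap) → IsTriangulation M
    → (R : Fin (d M) → Lab) → IsRealizer M R
    → (v : Fin (d M)) → Internal M v → OrbitSize M (σ M) v 3
    → (M' : RawMap) → (D : Deletion M v M')
    → IsRealizer M' (λ x → R (Deletion.ι D x))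
lemma5p3 M triangulation R real v v-internal (_ , v-degree3 , _) M′ D =
  restrict-realizer triangulation v-internal v-degree3 D real
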